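{- Let $\mathcal{C}$ be a model category such that (1) for every fibration $f\colon B\to A$ the pullback functor $f^*\colon\mathcal{C}/A\to\mathcal{C}/B$ has a right adjoint $\Pi_f$; (2) the class of cofibrations is closed under pullback along fibrations; (3) $\mathcal{C}$ is right proper. Then $\mathcal{C}$ is a logical model category.
   Context: A model category is a finitely complete and cocomplete category with classes of fibrations, cofibrations and weak equivalences such that weak equivalences satisfy two-out-of-three and (cofibrations, trivial fibrations) and (trivial cofibrations, fibrations) are weak factorization systems; trivial (co)fibrations are (co)fibrations that are weak equivalences. A model category is right proper if pullbacks of weak equivalences along fibrations are weak equivalences. A logical model category is a model category such that (i) for every fibration $f$ the pullback functor $f^*$ has a right adjoint $\Pi_f$, and (ii) the class of trivial cofibrations is closed under pullback along fibrations. -}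

module Defs where

open import Level using (Level; _⊔_) renaming (suc to lsuc)
open import Data.Product using (Σ; Σ-syntax; _×_; _,_; proj₁; proj₂)
open import Relation.Binary using (Rel; IsEquivalence)

record Category (o ℓ e : Level) : Set (lsuc (o ⊔ ℓ ⊔ e)) where
  infix  4 _≈_
  infixr 9 _∘_
  field
    Obj  : Set o
    _⇒_  : Obj → Obj → Set ℓ
    _≈_  : ∀ {A B} → Rel (A ⇒ B) e
    id   : ∀ {A} → A ⇒ A
    _∘_  : ∀ {A B C} → B ⇒ C → A ⇒ B → A ⇒ C
    assoc     : ∀ {A B C D} {f : A ⇒ B} {g : B ⇒ C} {h : C ⇒ D} →
                (h ∘ g) ∘ f ≈ h ∘ (g ∘ f)
    identityˡ : ∀ {A B} {f : A ⇒ B} → id ∘ f ≈ f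
    identityʳ : ∀ {A B} {f : A ⇒ B} → f ∘ id ≈ f
    equiv     : ∀ {A B} → IsEquivalence (_≈_ {A} {B})
    ∘-resp-≈  : ∀ {A B C} {f h : B ⇒ C} {g i : A ⇒ B} →
                f ≈ h → g ≈ i → f ∘ g ≈ h ∘ i

module _ {o ℓ e : Level} (C : Category o ℓ e) where
  open Category C

  IsPullback : ∀ {P X B A} → P ⇒ X → P ⇒ B → X ⇒ A → B ⇒ A → Set (o ⊔ ℓ ⊔ e)
  IsPullback {P} {X} {B} {A} p₁ p₂ g f =
    (g ∘ p₁ ≈ f ∘ p₂) ×
    (∀ {Q} (h₁ : Q ⇒ X) (h₂ : Q ⇒ B) → g ∘ h₁ ≈ f ∘ h₂ →
      Σ[ u ∈ Q ⇒ P ] ((p₁ ∘ u ≈ h₁) × (p₂ ∘ u ≈ h₂) ×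
        (∀ (v : Q ⇒ P) → p₁ ∘ v ≈ h₁ → p₂ ∘ v ≈ h₂ → v ≈ u)))

  IsPushout : ∀ {P X B A} → X ⇒ P → B ⇒ P → A ⇒ X → A ⇒ B → Set (o ⊔ ℓ ⊔ e)
  IsPushout {P} {X} {B} {A} i₁ i₂ g f =
    (i₁ ∘ g ≈ i₂ ∘ f) ×
    (∀ {Q} (h₁ : X ⇒ Q) (h₂ : B ⇒ Q) → h₁ ∘ g ≈ h₂ ∘ f →
      Σ[ u ∈ P ⇒ Q ] ((u ∘ i₁ ≈ h₁) × (u ∘ i₂ ≈ h₂) ×
        (∀ (v : P ⇒ Q) → v ∘ i₁ ≈ h₁ → v ∘ i₂ ≈ h₂ → v ≈ u)))

  IsTerminal : Obj → Set (o ⊔ ℓ ⊔ e)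
  IsTerminal T = ∀ X → Σ[ t ∈ X ⇒ T ] (∀ (t' : X ⇒ T) → t' ≈ t)

  IsInitial : Obj → Set (o ⊔ ℓ ⊔ e)
  IsInitial I = ∀ X → Σ[ t ∈ I ⇒ X ] (∀ (t' : I ⇒ X) → t' ≈ t)

  record Pullback {X B A} (g : X ⇒ A) (f : B ⇒ A) : Set (o ⊔ ℓ ⊔ e) where
    field
      P          : Obj
      p₁         : P ⇒ X
      p₂         : P ⇒ B
      isPullback : IsPullback p₁ p₂ g f

  record Pushout {X B A} (g : A ⇒ X) (f : A ⇒ B) : Set (o ⊔ ℓ ⊔ e) where
    field
      P         : Obj
      i₁        : X ⇒ P
      i₂        : B ⇒ P
      isPushout : IsPushout i₁ i₂ g f

  -- finite limits = terminal object + pullbacks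
  record FinitelyComplete : Set (o ⊔ ℓ ⊔ e) where
    field
      terminal    : Obj
      isTerminal  : IsTerminal terminal
      pullback    : ∀ {X B A} (g : X ⇒ A) (f : B ⇒ A) → Pullback g f

  -- finite colimits = initial object + pushouts
  record FinitelyCocomplete : Set (o ⊔ ℓ ⊔ e) where
    field
      initial    : Obj
      isInitial  : IsInitial initial
      pushout    : ∀ {X B A} (g : A ⇒ X) (f : A ⇒ B) → Pushout g f

  MorClass : (p : Level) → Set (o ⊔ ℓ ⊔ lsuc p)
  MorClass p = ∀ {A B} → A ⇒ B → Set p

  _∩_ : ∀ {p} → MorClass p → MorClass p → MorClass p
  (K ∩ L) f = K f × L f

  _⧄_ : ∀ {A B X Y} → A ⇒ B → X ⇒ Y → Set (ℓ ⊔ e)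
  _⧄_ {A} {B} {X} {Y} f g =
    ∀ (u : A ⇒ X) (v : B ⇒ Y) → g ∘ u ≈ v ∘ f →
      Σ[ d ∈ B ⇒ X ] ((d ∘ f ≈ u) × (g ∘ d ≈ v))

  record IsWFS {p} (L R : MorClass p) : Set (o ⊔ ℓ ⊔ e ⊔ p) where
    field
      factor : ∀ {A B} (f : A ⇒ B) →
               Σ[ M ∈ Obj ] Σ[ l ∈ A ⇒ M ] Σ[ r ∈ M ⇒ B ]
                 (L l × R r × (r ∘ l ≈ f))
      L⇒llp  : ∀ {A B} {f : A ⇒ B} → L f → ∀ {X Y} {g : X ⇒ Y} → R g → f ⧄ g
      llp⇒L  : ∀ {A B} {f : A ⇒ B} → (∀ {X Y} {g : X ⇒ Y} → R g → f ⧄ g) → L f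
      rlp⇒R  : ∀ {X Y} {g : X ⇒ Y} → (∀ {A B} {f : A ⇒ B} → L f → f ⧄ g) → R g

  TwoOutOfThree : ∀ {p} → MorClass p → Set (o ⊔ ℓ ⊔ p)
  TwoOutOfThree W = ∀ {A B C} (f : A ⇒ B) (g : B ⇒ C) →
    (W f → W g → W (g ∘ f)) × (W f → W (g ∘ f) → W g) × (W g → W (g ∘ f) → W f)

record ModelCategory {o ℓ e : Level} (C : Category o ℓ e) (p : Level)
       : Set (o ⊔ ℓ ⊔ e ⊔ lsuc p) where
  open Category C
  field
    finitelyComplete   : FinitelyComplete C
    finitelyCocomplete : FinitelyCocomplete C
    Fib Cof W          : MorClass C p
    twoOutOfThree      : TwoOutOfThree C W
    cof-trivFib        : IsWFS C Cof (_∩_ C Fib W)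
    trivCof-fib        : IsWFS C (_∩_ C Cof W) Fib

module ModelCategoryNotions {o ℓ e p : Level} {C : Category o ℓ e}
                            (M : ModelCategory C p) where
  open Category C
  open ModelCategory M
  open FinitelyComplete finitelyComplete
  open IsEquivalence
  private module PB {X B A} {g : X ⇒ A} {f : B ⇒ A} (pb : Pullback C g f) =
                   Pullback pb

  SliceObj : Obj → Set (o ⊔ ℓ)
  SliceObj A = Σ[ X ∈ Obj ] (X ⇒ A)

  -- morphisms of the slice C/A (equality: ≈ of underlying morphisms)
  SliceHom : ∀ {A} → SliceObj A → SliceObj A → Set (ℓ ⊔ e)
  SliceHom (X , x) (Y , y) = Σ[ h ∈ X ⇒ Y ] (y ∘ h ≈ x)

  _∘ₛ_ : ∀ {A} {X Y Z : SliceObj A} → SliceHom Y Z → SliceHom X Y → SliceHom X Z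
  _∘ₛ_ {Z = (_ , z)} (h , hp) (k , kp) =
    h ∘ k , trans equiv (sym equiv assoc)
              (trans equiv (∘-resp-≈ hp (refl equiv)) kp)

  pb₀ : ∀ {A B} (f : B ⇒ A) → SliceObj A → SliceObj B
  pb₀ f (X , x) = PB.P (pullback x f) , PB.p₂ (pullback x f)

  pb₁ : ∀ {A B} (f : B ⇒ A) {X Y : SliceObj A} →
        SliceHom X Y → SliceHom (pb₀ f X) (pb₀ f Y)
  pb₁ f {X , x} {Y , y} (h , hp) =
    proj₁ u , proj₁ (proj₂ (proj₂ u))
    where
      px = pullback x f
      py = pullback y f
      sq : y ∘ (h ∘ PB.p₁ px) ≈ f ∘ PB.p₂ px
      sq = trans equiv (sym equiv assoc)
             (trans equiv (∘-resp-≈ hp (refl equiv)) (proj₁ (PB.isPullback px)))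
      u = proj₂ (PB.isPullback py) (h ∘ PB.p₁ px) (PB.p₂ px) sq

  -- f* has a right adjoint Π_f: every Y in C/B has a couniversal arrow
  -- ε : f*(Π_f Y) → Y  from f*  (Mac Lane, Thm IV.1.2)
  PullbackHasRightAdjoint : ∀ {A B} → B ⇒ A → Set (o ⊔ ℓ ⊔ e)
  PullbackHasRightAdjoint {A} {B} f =
    ∀ (Y : SliceObj B) →
      Σ[ R ∈ SliceObj A ] Σ[ ε ∈ SliceHom (pb₀ f R) Y ]
        (∀ (X : SliceObj A) (g : SliceHom (pb₀ f X) Y) →
          Σ[ g' ∈ SliceHom X R ]
            ((proj₁ (ε ∘ₛ pb₁ f g') ≈ proj₁ g) ×
             (∀ (g'' : SliceHom X R) → proj₁ (ε ∘ₛ pb₁ f g'') ≈ proj₁ g →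
                proj₁ g'' ≈ proj₁ g')))

  ClosedUnderPullbackAlongFib : MorClass C p → Set (o ⊔ ℓ ⊔ e ⊔ p)
  ClosedUnderPullbackAlongFib K =
    ∀ {P X B A} {p₁ : P ⇒ X} {p₂ : P ⇒ B} {g : X ⇒ A} {f : B ⇒ A} →
      IsPullback C p₁ p₂ g f → Fib f → K g → K p₂

  RightProper : Set (o ⊔ ℓ ⊔ e ⊔ p)
  RightProper = ClosedUnderPullbackAlongFib W

  record IsLogical : Set (o ⊔ ℓ ⊔ e ⊔ p) where
    field
      Π-exists      : ∀ {A B} (f : B ⇒ A) → Fib f → PullbackHasRightAdjoint f
      trivCof-stable : ClosedUnderPullbackAlongFib (_∩_ C Cof W)

module Submission where

open import Defs
open import Level using (Level)
open import Data.Product using (_×_; _,_)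

module _ {o ℓ e p : Level} {C : Category o ℓ e} (M : ModelCategory C p) where
  open ModelCategory M
  open ModelCategoryNotions M

  ∩-closedUnderPullbackAlongFib : ∀ {K L : MorClass C p} →
    ClosedUnderPullbackAlongFib K → ClosedUnderPullbackAlongFib L →
    ClosedUnderPullbackAlongFib (_∩_ C K L)
  ∩-closedUnderPullbackAlongFib K-stable L-stable pb fib-f (Kg , Lg) =
    K-stable pb fib-f Kg , L-stable pb fib-f Lg

corollary4p2 : ∀ {o ℓ e p : Level} {C : Category o ℓ e} (M : ModelCategory C p) →
    let open Category C
        open ModelCategory M
        open ModelCategoryNotions M
    in (∀ {A B} (f : B ⇒ A) → Fib f → PullbackHasRightAdjoint f) →
       ClosedUnderPullbackAlongFib Cof →
       RightProper →
       IsLogical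
corollary4p2 M Π-exists cof-stable rightProper = record
  { Π-exists       = Π-exists
  ; trivCof-stable = ∩-closedUnderPullbackAlongFib M cof-stable rightProper
  }
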